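{- For all integers $k\ge 1$, $m\ge 1$, $n\ge 1$ and $k_1,\ldots,k_m\ge 1$, $$t(F^kM^{k_1,k_2,\ldots,k_m}K_{m,n})=(k_1+k_2+\cdots+k_m)^{n-1}\,k\,\Big(\prod_{i=1}^m(k+k_in)\Big)\sum_{i=1}^m\frac{k_i}{k+k_in}.$$ In particular, if $k_i=s$ for every $i=1,\ldots,m$, then $$t(F^kM^{s,s,\ldots,s}K_{m,n})=s^n m^n k\,(k+sn)^{m-1}.$$
   Context: Graphs may have multiple edges; $t(G)$ denotes the number of spanning trees of $G$, with parallel edges distinguished. The generalized complete bipartite graph $M^{k_1,\ldots,k_m}K_{m,n}$ has vertex set $V_1\cup V_2$ with $V_1=\{p_1,\ldots,p_n\}$ and $V_2=\{q_1,\ldots,q_m\}$, where for each $i\in\{1,\ldots,m\}$ and $j\in\{1,\ldots,n\}$ the vertices $q_i$ and $p_j$ are joined by exactly $k_i$ parallel edges and there are no other edges. The generalized half cone $F^kM^{k_1,\ldots,k_m}K_{m,n}$ is obtained from $M^{k_1,\ldots,k_m}K_{m,n}$ by adding a new vertex $p$ and joining $p$ to each $q_j$ ($j=1,\ldots,m$) by exactly $k$ parallel edges. -}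

module Defs where

open import Data.Bool using (Bool; true; false; if_then_else_; _∧_)
open import Data.Nat as ℕ using (ℕ; zero; suc; _+_; _*_; _∸_; _≡ᵇ_)
open import Data.Fin using (Fin)
import Data.Fin as Fin
open import Data.List using (List; []; _∷_; _++_; map; length; replicate; upTo; concatMap; filterᵇ)
open import Data.Maybe using (Maybe; just; nothing)
open import Data.Product using (_×_; _,_)
open import Data.Integer using (+_)
open import Data.Rational as ℚ using (ℚ)

-- Vertices are the naturals 0 … nV-1; edges are a list of
-- (unordered) endpoint pairs.  Parallel edges are distinct list entries,
-- so they are distinguished (edges are identified by their position).

record MultiGraph : Set where
  constructor mkGraph
  field
    nV    : ℕ
    edges : List (ℕ × ℕ)

open MultiGraph public

subsets : {A : Set} → List A → List (List A)
subsets []       = [] ∷ []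
subsets (x ∷ xs) = map (x ∷_) (subsets xs) ++ subsets xs

allᵇ : {A : Set} → (A → Bool) → List A → Bool
allᵇ p []       = true
allᵇ p (x ∷ xs) = p x ∧ allᵇ p xs

-- Component labelling: c v is the label of the component of v.
-- Adding edge (u , v) merges the component of v into that of u.
merge : (ℕ → ℕ) → ℕ → ℕ → (ℕ → ℕ)
merge c u v w = if c w ≡ᵇ c v then c u else c w

-- Add the edges one at a time; fail (nothing) as soon as an edge joins two
-- vertices already connected, i.e. as soon as the edge set contains a cycle
-- (loops included).
forestLabels : (ℕ → ℕ) → List (ℕ × ℕ) → Maybe (ℕ → ℕ)
forestLabels c []              = just c
forestLabels c ((u , v) ∷ es) =
  if c u ≡ᵇ c v then nothing else forestLabels (merge c u v) es

isSpanningTree : ℕ → List (ℕ × ℕ) → Bool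
isSpanningTree nV T with forestLabels (λ w → w) T
... | nothing = false
... | just c  = allᵇ (λ w → c w ≡ᵇ c 0) (upTo nV)

t : MultiGraph → ℕ
t G = length (filterᵇ (isSpanningTree (nV G)) (subsets (edges G)))

-- The generalized half cone  F^k M^{k_1,…,k_m} K_{m,n}.
-- p_j ↦ j (j < n),  q_i ↦ n + i (i < m),  p ↦ n + m.

allFinL : (m : ℕ) → List (Fin m)
allFinL zero    = []
allFinL (suc m) = Fin.zero ∷ map Fin.suc (allFinL m)

halfCone : (k m n : ℕ) → (Fin m → ℕ) → MultiGraph
halfCone k m n ks = mkGraph (suc (n + m))
  ( concatMap (λ i → concatMap (λ j → replicate (ks i) (n + Fin.toℕ i , j)) (upTo n)) (allFinL m)
  ++ concatMap (λ i → replicate k (n + m , n + Fin.toℕ i)) (allFinL m))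

sumF : (m : ℕ) → (Fin m → ℕ) → ℕ
sumF zero    f = 0
sumF (suc m) f = f Fin.zero + sumF m (λ i → f (Fin.suc i))

sumQ : (m : ℕ) → (Fin m → ℚ) → ℚ
sumQ zero    f = ℚ.0ℚ
sumQ (suc m) f = f Fin.zero ℚ.+ sumQ m (λ i → f (Fin.suc i))

prodQ : (m : ℕ) → (Fin m → ℚ) → ℚ
prodQ zero    f = ℚ.1ℚ
prodQ (suc m) f = f Fin.zero ℚ.* prodQ m (λ i → f (Fin.suc i))

ι : ℕ → ℚ
ι a = + a ℚ./ 1

powQ : ℚ → ℕ → ℚ
powQ x zero    = ℚ.1ℚ
powQ x (suc e) = x ℚ.* powQ x e

-- a / b as a rational (b = 0 never occurs in the statement; 0 by convention)
_/ₙ_ : ℕ → ℕ → ℚ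
a /ₙ zero  = ℚ.0ℚ
a /ₙ suc b = + a ℚ./ suc b

-- Spanning trees are counted by deletion–contraction on weighted edges, an edge of weight w
-- standing for w parallel edges.  Expanding the m cone edges p q_i (weight k) contracts a set
-- C of the q_i into the apex p and deletes the others; what is left is a complete bipartite
-- graph between the p_j and the weighted vertices p (weight Σ_{i∈C} k_i) and q_i (weight k_i,
-- i ∉ C).  Such a weighted biclique with total weight S and vertex weights x has
-- ∏ x · S^(n-1) · n^(#x-1) spanning trees, again by expanding the star at one p_j.  Summing
-- k^|C| times these counts over all C gives S^(n-1) Σ_i k k_i ∏_{j≠i} (k + k_j n).
-- Counts are multiplied by S throughout, so that the exponent n - 1 never has to appear.
module Submission where

open import Defs
open import Data.Bool using (Bool; true; false; if_then_else_; _∧_)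
open import Data.Nat using (ℕ; zero; suc; _+_; _*_; _∸_; _^_; _≤_; _≡ᵇ_; _≟_; z≤n; s≤s; >-nonZero)
open import Data.Nat.Properties
open import Data.Nat.ListAction using (sum; product)
open import Data.Nat.Tactic.RingSolver using (solve-∀)
open import Data.List using (List; []; _∷_; _++_; map; length; replicate; concatMap; upTo; applyUpTo; filterᵇ)
import Data.List.Properties as List
open import Data.List.Membership.Propositional using (_∈_)
open import Data.List.Membership.Propositional.Properties using (∈-map⁺; ∈-upTo⁺)
open import Data.List.Relation.Unary.Any using (here; there)
open import Data.List.Relation.Binary.Permutation.Propositional as ↭ using (_↭_; ↭⇒↭ₛ)
import Data.List.Relation.Binary.Permutation.Propositional.Properties as ↭
import Data.List.Relation.Binary.Permutation.Setoid.Properties as ↭ₛ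
open import Data.List.Relation.Unary.All as All using (All; []; _∷_)
import Data.List.Relation.Unary.All.Properties as All
open import Data.List.Relation.Unary.Unique.Propositional using (Unique)
import Data.List.Relation.Unary.Unique.Propositional.Properties as Unique
open import Data.List.Relation.Unary.AllPairs using ([]; _∷_)
open import Data.List.Relation.Binary.Subset.Propositional using (_⊆_)
import Data.List.Relation.Binary.Subset.Propositional.Properties as ⊆
open import Data.Maybe using (just; nothing)
open import Data.Fin using (Fin; toℕ)
import Data.Fin as Fin
open import Data.Product using (_×_; _,_; proj₁; proj₂)
import Data.Integer as ℤ
import Data.Integer.Properties as ℤ
open import Data.Rational using (toℚᵘ) renaming (_*_ to _*ℚ_)
import Data.Rational as ℚ
import Data.Rational.Properties as ℚ
open import Data.Rational.Solver renaming (module +-*-Solver to ℚ-Solver)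
open import Data.Rational.Unnormalised using (ℚᵘ; mkℚᵘ; *≡*) renaming (_≃_ to _≃ᵘ_)
import Data.Rational.Unnormalised as ℚᵘ
import Data.Rational.Unnormalised.Properties as ℚᵘ
open import Data.Sum using (_⊎_; inj₁; inj₂)
open import Function using (_∘_)
open import Relation.Nullary using (yes; no; contradiction)
open import Relation.Nullary.Decidable using (proof; dec-true; dec-false)
open import Relation.Nullary.Reflects using (Reflects; ofʸ; ofⁿ)
open import Relation.Binary.PropositionalEquality

≡ᵇ-reflects : ∀ a b → Reflects (a ≡ b) (a ≡ᵇ b)
≡ᵇ-reflects a b = proof (a ≟ b)

≡ᵇ-true : ∀ {a b} → a ≡ b → (a ≡ᵇ b) ≡ true
≡ᵇ-true {a} {b} = dec-true (a ≟ b)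

≡ᵇ-false : ∀ {a b} → a ≢ b → (a ≡ᵇ b) ≡ false
≡ᵇ-false {a} {b} = dec-false (a ≟ b)

≡ᵇ-sound : ∀ {a b} → (a ≡ᵇ b) ≡ true → a ≡ b
≡ᵇ-sound {a} {b} e with a ≡ᵇ b | ≡ᵇ-reflects a b
... | true | ofʸ p = p

≡ᵇ-cong : ∀ {a b a′ b′} → (a ≡ b → a′ ≡ b′) → (a′ ≡ b′ → a ≡ b) → (a ≡ᵇ b) ≡ (a′ ≡ᵇ b′)
≡ᵇ-cong {a} {b} f g with a ≡ᵇ b | ≡ᵇ-reflects a b
... | true  | ofʸ p  = sym (≡ᵇ-true (f p))
... | false | ofⁿ ¬p = sym (≡ᵇ-false (¬p ∘ g))

Bool-ext : ∀ {a b : Bool} → (a ≡ true → b ≡ true) → (b ≡ true → a ≡ true) → a ≡ b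
Bool-ext {true}  {true}  f g = refl
Bool-ext {true}  {false} f g = sym (f refl)
Bool-ext {false} {true}  f g = g refl
Bool-ext {false} {false} f g = refl

allᵇ-sound : ∀ {A : Set} (f : A → Bool) V → allᵇ f V ≡ true → ∀ {x} → x ∈ V → f x ≡ true
allᵇ-sound f (y ∷ V) e m with f y in fy
allᵇ-sound f (y ∷ V) e (here refl) | true = fy
allᵇ-sound f (y ∷ V) e (there m)   | true = allᵇ-sound f V e m

allᵇ-complete : ∀ {A : Set} (f : A → Bool) V → (∀ {x} → x ∈ V → f x ≡ true) → allᵇ f V ≡ true
allᵇ-complete f []      h = refl
allᵇ-complete f (y ∷ V) h rewrite h (here refl) = allᵇ-complete f V (h ∘ there)

allᵇ-cong : ∀ {A : Set} {f g : A → Bool} → (∀ w → f w ≡ g w) → ∀ V → allᵇ f V ≡ allᵇ g V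
allᵇ-cong fg []      = refl
allᵇ-cong fg (x ∷ V) = cong₂ _∧_ (fg x) (allᵇ-cong fg V)

allᵇ-map : ∀ {A B : Set} (f : B → Bool) (σ : A → B) V → allᵇ (f ∘ σ) V ≡ allᵇ f (map σ V)
allᵇ-map f σ []      = refl
allᵇ-map f σ (x ∷ V) = cong (f (σ x) ∧_) (allᵇ-map f σ V)

allᵇ-⊆ : ∀ {A : Set} (f : A → Bool) {V W} → V ⊆ W → allᵇ f W ≡ true → allᵇ f V ≡ true
allᵇ-⊆ f {V} {W} V⊆W e = allᵇ-complete f V (allᵇ-sound f W e ∘ V⊆W)

_≐_ : List ℕ → List ℕ → Set
V ≐ W = V ⊆ W × W ⊆ V

≐-trans : ∀ {U V W} → U ≐ V → V ≐ W → U ≐ W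
≐-trans (U⊆V , V⊆U) (V⊆W , W⊆V) = ⊆.⊆-trans U⊆V V⊆W , ⊆.⊆-trans W⊆V V⊆U

↭⇒≐ : ∀ {V W} → V ↭ W → V ≐ W
↭⇒≐ p = ⊆.⊆-reflexive-↭ p , ⊆.⊆-reflexive-↭ (↭.↭-sym p)

≐-map : ∀ (σ : ℕ → ℕ) {V W} → V ≐ W → map σ V ≐ map σ W
≐-map σ (V⊆W , W⊆V) = ⊆.map⁺ σ V⊆W , ⊆.map⁺ σ W⊆V

≐-dup : ∀ x xs → (x ∷ x ∷ xs) ≐ (x ∷ xs)
≐-dup x xs = (λ { (here e) → here e ; (there m) → m }) , there

Unique-resp-↭ : ∀ {V W : List ℕ} → V ↭ W → Unique V → Unique W
Unique-resp-↭ p = ↭ₛ.Unique-resp-↭ (setoid ℕ) (↭⇒↭ₛ p)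

Labelling : Set
Labelling = ℕ → ℕ

_⊑_ : Labelling → Labelling → Set
c ⊑ d = ∀ x y → c x ≡ c y → d x ≡ d y

⊑-trans : ∀ {c d e} → c ⊑ d → d ⊑ e → c ⊑ e
⊑-trans p q x y = q x y ∘ p x y

merge-coarsens : ∀ c u v → c ⊑ merge c u v
merge-coarsens c u v x y = cong (λ a → if a ≡ᵇ c v then c u else a)

merge-identifies : ∀ c u v → merge c u v u ≡ merge c u v v
merge-identifies c u v rewrite ≡ᵇ-true (refl {x = c v}) with c u ≡ᵇ c v
... | true  = refl
... | false = refl

merge-fixes-source : ∀ c u v → merge c u v u ≡ c u
merge-fixes-source c u v with c u ≡ᵇ c v
... | true  = refl
... | false = refl

merge-fixes : ∀ c u v {w} → c v ≢ c w → merge c u v w ≡ c w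
merge-fixes c u v {w} cv≢cw = cong (λ b → if b then c u else c w) (≡ᵇ-false (cv≢cw ∘ sym))

merge-cases : ∀ c u v x y → merge c u v x ≡ merge c u v y →
  c x ≡ c y ⊎ (c x ≡ c u × c y ≡ c v) ⊎ (c x ≡ c v × c y ≡ c u)
merge-cases c u v x y e
  with c x ≡ᵇ c v | ≡ᵇ-reflects (c x) (c v) | c y ≡ᵇ c v | ≡ᵇ-reflects (c y) (c v)
... | true  | ofʸ p | true  | ofʸ q = inj₁ (trans p (sym q))
... | true  | ofʸ p | false | _     = inj₂ (inj₂ (p , sym e))
... | false | _     | true  | ofʸ q = inj₂ (inj₁ (e , q))
... | false | _     | false | _     = inj₁ e

merge-least : ∀ {c d} u v → c ⊑ d → d u ≡ d v → merge c u v ⊑ d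
merge-least {c} {d} u v c⊑d du≡dv x y e with merge-cases c u v x y e
... | inj₁ p                = c⊑d x y p
... | inj₂ (inj₁ (p , q)) = trans (c⊑d x u p) (trans du≡dv (sym (c⊑d y v q)))
... | inj₂ (inj₂ (p , q)) = trans (c⊑d x v p) (trans (sym du≡dv) (sym (c⊑d y u q)))

merge-mono : ∀ {c d} u v → c ⊑ d → merge c u v ⊑ merge d u v
merge-mono {d = d} u v c⊑d =
  merge-least u v (⊑-trans c⊑d (merge-coarsens d u v)) (merge-identifies d u v)

merge-sym : ∀ c u v → merge c u v ⊑ merge c v u
merge-sym c u v = merge-least u v (merge-coarsens c v u) (sym (merge-identifies c v u))

merge-comm : ∀ c u₁ v₁ u₂ v₂ → merge (merge c u₁ v₁) u₂ v₂ ⊑ merge (merge c u₂ v₂) u₁ v₁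
merge-comm c u₁ v₁ u₂ v₂ =
  merge-least u₂ v₂
    (merge-least u₁ v₁ (⊑-trans (merge-coarsens c u₂ v₂) (merge-coarsens c₂ u₁ v₁))
      (merge-identifies c₂ u₁ v₁))
    (merge-coarsens c₂ u₁ v₁ u₂ v₂ (merge-identifies c u₂ v₂))
  where c₂ = merge c u₂ v₂

merge-exchange : ∀ c u₁ v₁ u₂ v₂ → c u₂ ≢ c v₂ →
  merge c u₁ v₁ u₂ ≡ merge c u₁ v₁ v₂ → merge c u₂ v₂ u₁ ≡ merge c u₂ v₂ v₁
merge-exchange c u₁ v₁ u₂ v₂ ne e with merge-cases c u₁ v₁ u₂ v₂ e
... | inj₁ p                = contradiction p ne
... | inj₂ (inj₁ (p , q)) =
  trans (sym (merge-coarsens c u₂ v₂ u₂ u₁ p))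
    (trans (merge-identifies c u₂ v₂) (merge-coarsens c u₂ v₂ v₂ v₁ q))
... | inj₂ (inj₂ (p , q)) =
  trans (sym (merge-coarsens c u₂ v₂ v₂ u₁ q))
    (trans (sym (merge-identifies c u₂ v₂)) (merge-coarsens c u₂ v₂ u₂ v₁ p))

-- Weighted deletion–contraction

-- (u , v , w) stands for w parallel edges between u and v.
WEdge : Set
WEdge = ℕ × ℕ × ℕ

connects : Labelling → List ℕ → ℕ → Bool
connects c V r = allᵇ (λ w → c w ≡ᵇ c r) V

-- The number of edge sets T ⊆ es (with multiplicity) that are forests modulo c and
-- connect all of V to r modulo c ∪ T, computed by deletion–contraction.

trees : Labelling → List ℕ → ℕ → List WEdge → ℕ
trees c V r []                 = if connects c V r then 1 else 0
trees c V r ((u , v , w) ∷ es) =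
  (if c u ≡ᵇ c v then 0 else w * trees (merge c u v) V r es) + trees c V r es

τ : List ℕ → ℕ → List WEdge → ℕ
τ = trees (λ w → w)

trees-cong : ∀ {c d} → c ⊑ d → d ⊑ c → ∀ V r es → trees c V r es ≡ trees d V r es
trees-cong {c} {d} c⊑d d⊑c V r [] =
  cong (λ b → if b then 1 else 0) (allᵇ-cong (λ w → ≡ᵇ-cong (c⊑d w r) (d⊑c w r)) V)
trees-cong {c} {d} c⊑d d⊑c V r ((u , v , w) ∷ es) =
  cong₂ _+_
    (cong₂ (λ b n → if b then 0 else w * n) (≡ᵇ-cong (c⊑d u v) (d⊑c u v))
      (trees-cong (merge-mono u v c⊑d) (merge-mono u v d⊑c) V r es))
    (trees-cong c⊑d d⊑c V r es)

trees-loop : ∀ c V r u v w es → c u ≡ c v → trees c V r ((u , v , w) ∷ es) ≡ trees c V r es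
trees-loop c V r u v w es cu≡cv rewrite ≡ᵇ-true cu≡cv = refl

trees-swap-loop : ∀ c V r u v w e es → c u ≡ c v →
  trees c V r ((u , v , w) ∷ e ∷ es) ≡ trees c V r (e ∷ (u , v , w) ∷ es)
trees-swap-loop c V r u v w e@(u′ , v′ , w′) es cu≡cv = begin
  trees c V r ((u , v , w) ∷ e ∷ es)
    ≡⟨ trees-loop c V r u v w (e ∷ es) cu≡cv ⟩
  (if c u′ ≡ᵇ c v′ then 0 else w′ * trees (merge c u′ v′) V r es) + trees c V r es
    ≡⟨ cong₂ (λ a b → (if c u′ ≡ᵇ c v′ then 0 else w′ * a) + b)
         (trees-loop (merge c u′ v′) V r u v w es (merge-coarsens c u′ v′ u v cu≡cv))
         (trees-loop c V r u v w es cu≡cv) ⟨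
  trees c V r (e ∷ (u , v , w) ∷ es) ∎
  where open ≡-Reasoning

trees-swap-nonloops : ∀ c V r u₁ v₁ w₁ u₂ v₂ w₂ es → c u₁ ≢ c v₁ → c u₂ ≢ c v₂ →
  trees c V r ((u₁ , v₁ , w₁) ∷ (u₂ , v₂ , w₂) ∷ es) ≡ trees c V r ((u₂ , v₂ , w₂) ∷ (u₁ , v₁ , w₁) ∷ es)
trees-swap-nonloops c V r u₁ v₁ w₁ u₂ v₂ w₂ es ¬loop₁ ¬loop₂
  rewrite ≡ᵇ-false ¬loop₁ | ≡ᵇ-false ¬loop₂
  with merge c u₁ v₁ u₂ ≟ merge c u₁ v₁ v₂
... | yes e rewrite ≡ᵇ-true e | ≡ᵇ-true (merge-exchange c u₁ v₁ u₂ v₂ ¬loop₂ e) = lemma w₁ w₂ _ _ _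
  where
    lemma : ∀ w₁ w₂ Y₁ Y₂ Z → w₁ * (0 + Y₁) + (w₂ * Y₂ + Z) ≡ w₂ * (0 + Y₂) + (w₁ * Y₁ + Z)
    lemma = solve-∀
... | no ¬e rewrite ≡ᵇ-false ¬e | ≡ᵇ-false (¬e ∘ merge-exchange c u₂ v₂ u₁ v₁ ¬loop₁) =
  trans (cong (λ X → w₁ * (w₂ * X + _) + (w₂ * _ + _))
          (trees-cong (merge-comm c u₁ v₁ u₂ v₂) (merge-comm c u₂ v₂ u₁ v₁) V r es))
    (lemma w₁ w₂ _ _ _ _)
  where
    lemma : ∀ w₁ w₂ X Y₁ Y₂ Z → w₁ * (w₂ * X + Y₁) + (w₂ * Y₂ + Z) ≡ w₂ * (w₁ * X + Y₂) + (w₁ * Y₁ + Z)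
    lemma = solve-∀

trees-swap : ∀ c V r e₁ e₂ es → trees c V r (e₁ ∷ e₂ ∷ es) ≡ trees c V r (e₂ ∷ e₁ ∷ es)
trees-swap c V r (u₁ , v₁ , w₁) (u₂ , v₂ , w₂) es with c u₁ ≟ c v₁ | c u₂ ≟ c v₂
... | yes loop₁ | _          = trees-swap-loop c V r u₁ v₁ w₁ (u₂ , v₂ , w₂) es loop₁
... | no _      | yes loop₂  = sym (trees-swap-loop c V r u₂ v₂ w₂ (u₁ , v₁ , w₁) es loop₂)
... | no ¬loop₁ | no ¬loop₂ = trees-swap-nonloops c V r u₁ v₁ w₁ u₂ v₂ w₂ es ¬loop₁ ¬loop₂

trees-∷ : ∀ V r {es es′} → (∀ c → trees c V r es ≡ trees c V r es′) →
  ∀ e c → trees c V r (e ∷ es) ≡ trees c V r (e ∷ es′)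
trees-∷ V r h (u , v , w) c =
  cong₂ _+_ (cong (λ n → if c u ≡ᵇ c v then 0 else w * n) (h (merge c u v))) (h c)

trees-↭ : ∀ c V r {es es′} → es ↭ es′ → trees c V r es ≡ trees c V r es′
trees-↭ c V r ↭.refl            = refl
trees-↭ c V r (↭.prep {xs} {ys} e p) = trees-∷ V r {xs} {ys} (λ c′ → trees-↭ c′ V r p) e c
trees-↭ c V r (↭.swap {xs} {ys} e₁ e₂ p) =
  trans (trees-swap c V r e₁ e₂ xs)
    (trees-∷ V r {e₁ ∷ xs} {e₁ ∷ ys} (trees-∷ V r {xs} {ys} (λ c′ → trees-↭ c′ V r p) e₁) e₂ c)
trees-↭ c V r (↭.trans p q)     = trans (trees-↭ c V r p) (trees-↭ c V r q)

record _≋_ (es es′ : List WEdge) : Set where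
  constructor mk≋
  field run : ∀ c V r rest → trees c V r (es ++ rest) ≡ trees c V r (es′ ++ rest)
open _≋_

≋-refl : ∀ {es} → es ≋ es
≋-refl = mk≋ λ c V r rest → refl

≋-reflexive : ∀ {es es′} → es ≡ es′ → es ≋ es′
≋-reflexive refl = ≋-refl

≋-sym : ∀ {es es′} → es ≋ es′ → es′ ≋ es
≋-sym p = mk≋ λ c V r rest → sym (run p c V r rest)

≋-trans : ∀ {es₁ es₂ es₃} → es₁ ≋ es₂ → es₂ ≋ es₃ → es₁ ≋ es₃
≋-trans p q = mk≋ λ c V r rest → trans (run p c V r rest) (run q c V r rest)

↭⇒≋ : ∀ {es es′} → es ↭ es′ → es ≋ es′
↭⇒≋ p = mk≋ λ c V r rest → trees-↭ c V r (↭.++⁺ʳ rest p)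

≋⇒trees : ∀ {es es′} → es ≋ es′ → ∀ c V r → trees c V r es ≡ trees c V r es′
≋⇒trees {es} {es′} p c V r =
  subst₂ (λ A B → trees c V r A ≡ trees c V r B)
    (List.++-identityʳ es) (List.++-identityʳ es′) (run p c V r [])

≋-++ˡ : ∀ xs {es es′} → es ≋ es′ → (xs ++ es) ≋ (xs ++ es′)
≋-++ˡ xs {es} {es′} p = mk≋ (go xs)
  where
    go : ∀ xs c V r rest → trees c V r ((xs ++ es) ++ rest) ≡ trees c V r ((xs ++ es′) ++ rest)
    go []       = run p
    go (e ∷ xs) c V r rest = trees-∷ V r {(xs ++ es) ++ rest} {(xs ++ es′) ++ rest} (λ c′ → go xs c′ V r rest) e c

≋-++ʳ : ∀ {es es′} ys → es ≋ es′ → (es ++ ys) ≋ (es′ ++ ys)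
≋-++ʳ {es} {es′} ys p = mk≋ λ c V r rest →
  subst₂ (λ A B → trees c V r A ≡ trees c V r B)
    (sym (List.++-assoc es ys rest)) (sym (List.++-assoc es′ ys rest))
    (run p c V r (ys ++ rest))

≋-++ : ∀ {es₁ es₁′ es₂ es₂′} → es₁ ≋ es₁′ → es₂ ≋ es₂′ → (es₁ ++ es₂) ≋ (es₁′ ++ es₂′)
≋-++ {es₁′ = es₁′} {es₂ = es₂} p q = ≋-trans (≋-++ʳ es₂ p) (≋-++ˡ es₁′ q)

≋-weight-0 : ∀ u v → ((u , v , 0) ∷ []) ≋ []
≋-weight-0 u v = mk≋ λ c V r rest → lemma (c u ≡ᵇ c v)
  where
    lemma : ∀ {n} b → (if b then 0 else 0 * n) + n ≡ n
    lemma true  = refl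
    lemma false = refl

-- After contracting one of two parallel edges the other is a loop.
≋-parallel : ∀ u v a b → ((u , v , a) ∷ (u , v , b) ∷ []) ≋ ((u , v , a + b) ∷ [])
≋-parallel u v a b = mk≋ λ c V r rest →
  trans (cong (λ X → (if c u ≡ᵇ c v then 0 else a * X) + trees c V r ((u , v , b) ∷ rest))
          (trees-loop (merge c u v) V r u v b rest (merge-identifies c u v)))
        (lemma (c u ≡ᵇ c v) (trees (merge c u v) V r rest) (trees c V r rest))
  where
    lemma : ∀ β Y Z → (if β then 0 else a * Y) + ((if β then 0 else b * Y) + Z)
                    ≡ (if β then 0 else (a + b) * Y) + Z
    lemma true  Y Z = refl
    lemma false Y Z = trans (sym (+-assoc (a * Y) (b * Y) Z)) (cong (_+ Z) (sym (*-distribʳ-+ Y a b)))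

≋-flip : ∀ u v w → ((u , v , w) ∷ []) ≋ ((v , u , w) ∷ [])
≋-flip u v w = mk≋ λ c V r rest →
  cong (_+ trees c V r rest)
    (cong₂ (λ b n → if b then 0 else w * n) (≡ᵇ-cong {c u} {c v} sym sym)
      (trees-cong (merge-sym c u v) (merge-sym c v u) V r rest))

≋-concatMap : ∀ {A : Set} {f g : A → List WEdge} → (∀ x → f x ≋ g x) → ∀ xs → concatMap f xs ≋ concatMap g xs
≋-concatMap h []       = ≋-refl
≋-concatMap h (x ∷ xs) = ≋-++ (h x) (≋-concatMap h xs)

≋-map : ∀ {A : Set} {f g : A → WEdge} → (∀ x → (f x ∷ []) ≋ (g x ∷ [])) → ∀ xs → map f xs ≋ map g xs
≋-map h []       = ≋-refl
≋-map h (x ∷ xs) = ≋-++ (h x) (≋-map h xs)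

rename : (ℕ → ℕ) → List WEdge → List WEdge
rename σ = map (λ (u , v , w) → (σ u , σ v , w))

trees-rename : ∀ d σ V r es → trees (d ∘ σ) V r es ≡ trees d (map σ V) (σ r) (rename σ es)
trees-rename d σ V r [] = cong (λ b → if b then 1 else 0) (allᵇ-map (λ w → d w ≡ᵇ d (σ r)) σ V)
trees-rename d σ V r ((u , v , w) ∷ es) =
  cong₂ _+_
    (cong (λ n → if d (σ u) ≡ᵇ d (σ v) then 0 else w * n) (trees-rename (merge d (σ u) (σ v)) σ V r es))
    (trees-rename d σ V r es)

trees-cong-target : ∀ {V r V′ r′} → (∀ c → connects c V r ≡ connects c V′ r′) →
  ∀ c es → trees c V r es ≡ trees c V′ r′ es
trees-cong-target h c []                 = cong (λ b → if b then 1 else 0) (h c)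
trees-cong-target h c ((u , v , w) ∷ es) =
  cong₂ _+_ (cong (λ n → if c u ≡ᵇ c v then 0 else w * n) (trees-cong-target h (merge c u v) es))
            (trees-cong-target h c es)

trees-≐ : ∀ {V W} → V ≐ W → ∀ r c es → trees c V r es ≡ trees c W r es
trees-≐ (V⊆W , W⊆V) r = trees-cong-target λ c →
  Bool-ext (allᵇ-⊆ (λ w → c w ≡ᵇ c r) W⊆V) (allᵇ-⊆ (λ w → c w ≡ᵇ c r) V⊆W)

trees-root : ∀ V {r r′} → r ∈ V → r′ ∈ V → ∀ c es → trees c V r es ≡ trees c V r′ es
trees-root V r∈V r′∈V = trees-cong-target λ c →
  Bool-ext (reroot c r′∈V) (reroot c r∈V)
  where
    reroot : ∀ c {r r′} → r′ ∈ V → connects c V r ≡ true → connects c V r′ ≡ true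
    reroot c {r} {r′} r′∈V conn = allᵇ-complete (λ w → c w ≡ᵇ c r′) V λ w∈V →
      ≡ᵇ-true (trans (at w∈V) (sym (at r′∈V)))
      where
        at : ∀ {w} → w ∈ V → c w ≡ c r
        at = ≡ᵇ-sound ∘ allᵇ-sound (λ w → c w ≡ᵇ c r) V conn

-- From the edge-subset count t to trees

countᵇ : {A : Set} → (A → Bool) → List A → ℕ
countᵇ p []       = 0
countᵇ p (x ∷ xs) = (if p x then 1 else 0) + countᵇ p xs

length-filterᵇ : ∀ {A : Set} (p : A → Bool) xs → length (filterᵇ p xs) ≡ countᵇ p xs
length-filterᵇ p []       = refl
length-filterᵇ p (x ∷ xs) with p x
... | true  = cong suc (length-filterᵇ p xs)
... | false = length-filterᵇ p xs

countᵇ-++ : ∀ {A : Set} (p : A → Bool) xs ys → countᵇ p (xs ++ ys) ≡ countᵇ p xs + countᵇ p ys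
countᵇ-++ p []       ys = refl
countᵇ-++ p (x ∷ xs) ys =
  trans (cong ((if p x then 1 else 0) +_) (countᵇ-++ p xs ys)) (sym (+-assoc (if p x then 1 else 0) _ _))

countᵇ-map : ∀ {A B : Set} (p : B → Bool) (f : A → B) xs → countᵇ p (map f xs) ≡ countᵇ (p ∘ f) xs
countᵇ-map p f []       = refl
countᵇ-map p f (x ∷ xs) = cong ((if p (f x) then 1 else 0) +_) (countᵇ-map p f xs)

countᵇ-cong : ∀ {A : Set} {p q : A → Bool} → (∀ x → p x ≡ q x) → ∀ xs → countᵇ p xs ≡ countᵇ q xs
countᵇ-cong h []       = refl
countᵇ-cong h (x ∷ xs) = cong₂ (λ b n → (if b then 1 else 0) + n) (h x) (countᵇ-cong h xs)

countᵇ-if : ∀ {A : Set} b (p : A → Bool) xs →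
  countᵇ (λ x → if b then false else p x) xs ≡ (if b then 0 else countᵇ p xs)
countᵇ-if true  p []       = refl
countᵇ-if true  p (x ∷ xs) = countᵇ-if true p xs
countᵇ-if false p xs       = refl

isTree : Labelling → List ℕ → ℕ → List (ℕ × ℕ) → Bool
isTree c V r T with forestLabels c T
... | nothing = false
... | just c′ = connects c′ V r

isSpanningTree≡isTree : ∀ nV T → isSpanningTree nV T ≡ isTree (λ w → w) (upTo nV) 0 T
isSpanningTree≡isTree nV T with forestLabels (λ w → w) T
... | nothing = refl
... | just c  = refl

isTree-∷ : ∀ c V r u v T →
  isTree c V r ((u , v) ∷ T) ≡ (if c u ≡ᵇ c v then false else isTree (merge c u v) V r T)
isTree-∷ c V r u v T with c u ≡ᵇ c v
... | true  = refl
... | false = refl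

treeSets : Labelling → List ℕ → ℕ → List (ℕ × ℕ) → ℕ
treeSets c V r es = countᵇ (isTree c V r) (subsets es)

treeSets-∷ : ∀ c V r u v es → treeSets c V r ((u , v) ∷ es)
  ≡ (if c u ≡ᵇ c v then 0 else treeSets (merge c u v) V r es) + treeSets c V r es
treeSets-∷ c V r u v es = begin
  countᵇ (isTree c V r) (map ((u , v) ∷_) (subsets es) ++ subsets es)
    ≡⟨ countᵇ-++ (isTree c V r) (map ((u , v) ∷_) (subsets es)) (subsets es) ⟩
  countᵇ (isTree c V r) (map ((u , v) ∷_) (subsets es)) + treeSets c V r es
    ≡⟨ cong (_+ treeSets c V r es) (begin
        countᵇ (isTree c V r) (map ((u , v) ∷_) (subsets es))
          ≡⟨ countᵇ-map (isTree c V r) ((u , v) ∷_) (subsets es) ⟩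
        countᵇ (λ T → isTree c V r ((u , v) ∷ T)) (subsets es)
          ≡⟨ countᵇ-cong (isTree-∷ c V r u v) (subsets es) ⟩
        countᵇ (λ T → if c u ≡ᵇ c v then false else isTree (merge c u v) V r T) (subsets es)
          ≡⟨ countᵇ-if (c u ≡ᵇ c v) (isTree (merge c u v) V r) (subsets es) ⟩
        (if c u ≡ᵇ c v then 0 else treeSets (merge c u v) V r es) ∎) ⟩
  (if c u ≡ᵇ c v then 0 else treeSets (merge c u v) V r es) + treeSets c V r es ∎
  where open ≡-Reasoning

treeSets-loops : ∀ c V r u v w es → c u ≡ c v → treeSets c V r (replicate w (u , v) ++ es) ≡ treeSets c V r es
treeSets-loops c V r u v zero    es cu≡cv = refl
treeSets-loops c V r u v (suc w) es cu≡cv =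
  trans (treeSets-∷ c V r u v rest)
    (trans (cong (λ b → (if b then 0 else treeSets (merge c u v) V r rest) + treeSets c V r rest)
                 (≡ᵇ-true cu≡cv))
      (treeSets-loops c V r u v w es cu≡cv))
  where rest = replicate w (u , v) ++ es

treeSets-replicate : ∀ c V r u v w es → treeSets c V r (replicate w (u , v) ++ es)
  ≡ (if c u ≡ᵇ c v then 0 else w * treeSets (merge c u v) V r es) + treeSets c V r es
treeSets-replicate c V r u v zero es with c u ≡ᵇ c v
... | true  = refl
... | false = refl
treeSets-replicate c V r u v (suc w) es =
  trans (treeSets-∷ c V r u v (replicate w (u , v) ++ es))
    (trans (cong₂ (λ X Y → (if c u ≡ᵇ c v then 0 else X) + Y)
              (treeSets-loops (merge c u v) V r u v w es (merge-identifies c u v))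
              (treeSets-replicate c V r u v w es))
      (lemma (c u ≡ᵇ c v) (treeSets (merge c u v) V r es) (treeSets c V r es)))
  where
    lemma : ∀ b Y Z → (if b then 0 else Y) + ((if b then 0 else w * Y) + Z) ≡ (if b then 0 else suc w * Y) + Z
    lemma true  Y Z = refl
    lemma false Y Z = sym (+-assoc Y (w * Y) Z)

expand : List WEdge → List (ℕ × ℕ)
expand = concatMap (λ (u , v , w) → replicate w (u , v))

expand-concatMap : ∀ {A : Set} (f : A → List WEdge) xs → expand (concatMap f xs) ≡ concatMap (expand ∘ f) xs
expand-concatMap f []       = refl
expand-concatMap f (x ∷ xs) =
  trans (List.concatMap-++ _ (f x) (concatMap f xs)) (cong (expand (f x) ++_) (expand-concatMap f xs))

treeSets-expand : ∀ c V r es → treeSets c V r (expand es) ≡ trees c V r es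
treeSets-expand c V r [] with connects c V r
... | true  = refl
... | false = refl
treeSets-expand c V r ((u , v , w) ∷ es) =
  trans (treeSets-replicate c V r u v w (expand es))
    (cong₂ (λ X Y → (if c u ≡ᵇ c v then 0 else w * X) + Y)
      (treeSets-expand (merge c u v) V r es) (treeSets-expand c V r es))

t≡τ : ∀ G es → edges G ≡ expand es → t G ≡ τ (upTo (nV G)) 0 es
t≡τ G es E≡es = begin
  length (filterᵇ (isSpanningTree (nV G)) (subsets (edges G)))
    ≡⟨ length-filterᵇ (isSpanningTree (nV G)) (subsets (edges G)) ⟩
  countᵇ (isSpanningTree (nV G)) (subsets (edges G))
    ≡⟨ countᵇ-cong (isSpanningTree≡isTree (nV G)) (subsets (edges G)) ⟩
  treeSets (λ w → w) (upTo (nV G)) 0 (edges G)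
    ≡⟨ cong (treeSets (λ w → w) (upTo (nV G)) 0) E≡es ⟩
  treeSets (λ w → w) (upTo (nV G)) 0 (expand es)
    ≡⟨ treeSets-expand (λ w → w) (upTo (nV G)) 0 es ⟩
  τ (upTo (nV G)) 0 es ∎
  where open ≡-Reasoning

-- (ℓ , x) : the vertex ℓ carrying the weight x.
WVertex : Set
WVertex = ℕ × ℕ

labels : List WVertex → List ℕ
labels = map proj₁

weights : List WVertex → List ℕ
weights = map proj₂

relabel : (ℕ → ℕ) → List WVertex → List WVertex
relabel σ = map (λ (ℓ , x) → (σ ℓ , x))

fan : ℕ → List WVertex → List WEdge
fan p = map (λ (ℓ , x) → (p , ℓ , x))

biclique : List WVertex → List ℕ → List WEdge
biclique bl ps = concatMap (λ p → fan p bl) ps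

star : (ℕ → ℕ) → ℕ → List WVertex → List WEdge
star f z = map (λ (ℓ , x) → (z , ℓ , f x))

relabel-id : ∀ σ bl → All (λ ℓ → σ ℓ ≡ ℓ) (labels bl) → relabel σ bl ≡ bl
relabel-id σ bl fix = List.map-id-local (All.map (λ {b} e → cong (_, proj₂ b) e) (All.map⁻ fix))

rename-star : ∀ σ f z L → σ z ≡ z → All (λ ℓ → σ ℓ ≡ ℓ) (labels L) → rename σ (star f z L) ≡ star f z L
rename-star σ f z []            σz []          = refl
rename-star σ f z ((ℓ , x) ∷ L) σz (σℓ ∷ σL) =
  cong₂ _∷_ (cong₂ (λ a b → (a , b , f x)) σz σℓ) (rename-star σ f z L σz σL)

rename-biclique : ∀ σ bl ps → All (λ p → σ p ≡ p) ps → rename σ (biclique bl ps) ≡ biclique (relabel σ bl) ps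
rename-biclique σ bl []       []           = refl
rename-biclique σ bl (p ∷ ps) (σp ∷ σps) =
  trans (List.map-++ _ (fan p bl) (biclique bl ps)) (cong₂ _++_ (rename-fan bl) (rename-biclique σ bl ps σps))
  where
    rename-fan : ∀ bl → rename σ (fan p bl) ≡ fan p (relabel σ bl)
    rename-fan []             = refl
    rename-fan ((ℓ , x) ∷ bl) = cong₂ _∷_ (cong (λ q → (q , σ ℓ , x)) σp) (rename-fan bl)

biclique-↭ : ∀ {bl bl′} → bl ↭ bl′ → ∀ ps → biclique bl ps ↭ biclique bl′ ps
biclique-↭ p []        = ↭.refl
biclique-↭ p (q ∷ ps) = ↭.++⁺ (↭.map⁺ _ p) (biclique-↭ p ps)

starSum : (ℕ → ℕ) → (List WVertex → ℕ → ℕ) → List WVertex → ℕ → List WVertex → ℕ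
starSum f Φ D X []            = Φ D X
starSum f Φ D X ((ℓ , x) ∷ L) = f x * starSum f Φ D (X + x) L + starSum f Φ ((ℓ , x) ∷ D) X L

contract-edges : ∀ f z ℓ x X L D ps → All (ℓ ≢_) (labels L ++ labels D ++ ps) →
  rename (merge (λ w → w) z ℓ) (star f z L ++ biclique ((z , X) ∷ (ℓ , x) ∷ L ++ D) ps)
    ≋ (star f z L ++ biclique ((z , X + x) ∷ L ++ D) ps)
contract-edges f z ℓ x X L D ps ℓ∉ = ≋-trans (≋-reflexive renamed) (≋-++ˡ (star f z L) merged)
  where
    σ = merge (λ w → w) z ℓ

    fixes : All (λ w → σ w ≡ w) (labels L ++ labels D ++ ps)
    fixes = All.map (merge-fixes (λ w → w) z ℓ) ℓ∉

    fixes-L : All (λ w → σ w ≡ w) (labels L)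
    fixes-L = All.++⁻ˡ (labels L) fixes

    fixes-D : All (λ w → σ w ≡ w) (labels D)
    fixes-D = All.++⁻ˡ (labels D) (All.++⁻ʳ (labels L) fixes)

    fixes-ps : All (λ w → σ w ≡ w) ps
    fixes-ps = All.++⁻ʳ (labels D) (All.++⁻ʳ (labels L) fixes)

    σz : σ z ≡ z
    σz = merge-fixes-source (λ w → w) z ℓ

    relabelled : relabel σ ((z , X) ∷ (ℓ , x) ∷ L ++ D) ≡ (z , X) ∷ (z , x) ∷ L ++ D
    relabelled = cong₂ (λ (a , b) K → (a , X) ∷ (b , x) ∷ K)
      (cong₂ _,_ σz (trans (sym (merge-identifies (λ w → w) z ℓ)) σz))
      (trans (List.map-++ _ L D) (cong₂ _++_ (relabel-id σ L fixes-L) (relabel-id σ D fixes-D)))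

    renamed : rename σ (star f z L ++ biclique ((z , X) ∷ (ℓ , x) ∷ L ++ D) ps)
            ≡ star f z L ++ biclique ((z , X) ∷ (z , x) ∷ L ++ D) ps
    renamed = trans (List.map-++ _ (star f z L) (biclique ((z , X) ∷ (ℓ , x) ∷ L ++ D) ps))
      (cong₂ _++_ (rename-star σ f z L σz fixes-L)
                  (trans (rename-biclique σ _ ps fixes-ps) (cong (λ K → biclique K ps) relabelled)))

    merged : biclique ((z , X) ∷ (z , x) ∷ L ++ D) ps ≋ biclique ((z , X + x) ∷ L ++ D) ps
    merged = ≋-concatMap (λ p → ≋-++ʳ (fan p (L ++ D)) (≋-parallel p z X x)) ps

contract-vertices : ∀ z ℓ rest {V} → All (ℓ ≢_) rest → V ≐ (z ∷ ℓ ∷ rest) →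
  map (merge (λ w → w) z ℓ) V ≐ (z ∷ rest)
contract-vertices z ℓ rest ℓ∉ V≐ = ≐-trans (≐-map σ V≐)
  (subst (λ K → K ≐ (z ∷ rest))
    (sym (cong₂ _∷_ σz (cong₂ _∷_ (trans (sym (merge-identifies (λ w → w) z ℓ)) σz)
                                  (List.map-id-local (All.map (merge-fixes (λ w → w) z ℓ) ℓ∉)))))
    (≐-dup z rest))
  where
    σ = merge (λ w → w) z ℓ
    σz : σ z ≡ z
    σz = merge-fixes-source (λ w → w) z ℓ

-- Deletion–contraction along the star edges z ℓ (f x of them for each (ℓ , x) ∈ L):
-- contracting merges ℓ into z and adds x to the weight X of z, deleting moves (ℓ , x)
-- to D.  Once L is exhausted a weighted biclique is left, which base counts.
module StarContraction (f : ℕ → ℕ) (z : ℕ) (ps : List ℕ) (S : ℕ) (Φ : List WVertex → ℕ → ℕ)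
  (base : ∀ D X → Unique (z ∷ labels D ++ ps) → X + sum (weights D) ≡ S →
          S * τ (z ∷ labels D ++ ps) z (biclique ((z , X) ∷ D) ps) ≡ Φ D X) where

  star-trees : ∀ L D X V r → Unique (z ∷ labels L ++ labels D ++ ps) →
    X + (sum (weights L) + sum (weights D)) ≡ S → V ≐ (z ∷ labels L ++ labels D ++ ps) → r ∈ V →
    S * τ V r (star f z L ++ biclique ((z , X) ∷ L ++ D) ps) ≡ starSum f Φ D X L
  star-trees [] D X V r u ΣS V≐ r∈V = begin
    S * τ V r K  ≡⟨ cong (S *_) (trees-≐ V≐ r (λ w → w) K) ⟩
    S * τ W r K  ≡⟨ cong (S *_) (trees-root W (proj₁ V≐ r∈V) (here refl) (λ w → w) K) ⟩
    S * τ W z K  ≡⟨ base D X u ΣS ⟩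
    Φ D X        ∎
    where
      open ≡-Reasoning
      W = z ∷ labels D ++ ps
      K = biclique ((z , X) ∷ D) ps
  star-trees ((ℓ , x) ∷ L) D X V r u@((z≢ℓ ∷ z≢rest) ∷ ℓ≢rest ∷ u-rest) ΣS V≐ r∈V = begin
    S * τ V r ((z , ℓ , f x) ∷ R)
      ≡⟨ cong (λ b → S * ((if b then 0 else f x * trees σ V r R) + τ V r R)) (≡ᵇ-false z≢ℓ) ⟩
    S * (f x * trees σ V r R + τ V r R)
      ≡⟨ cong (λ n → S * (f x * n + τ V r R)) (trees-rename (λ w → w) σ V r R) ⟩
    S * (f x * τ (map σ V) (σ r) (rename σ R) + τ V r R)
      ≡⟨ distrib S (f x) _ _ ⟩
    f x * (S * τ (map σ V) (σ r) (rename σ R)) + S * τ V r R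
      ≡⟨ cong₂ (λ a b → f x * a + b) contracted deleted ⟩
    f x * starSum f Φ D (X + x) L + starSum f Φ ((ℓ , x) ∷ D) X L ∎
    where
      open ≡-Reasoning
      R = star f z L ++ biclique ((z , X) ∷ (ℓ , x) ∷ L ++ D) ps
      σ = merge (λ w → w) z ℓ

      distrib : ∀ S a A B → S * (a * A + B) ≡ a * (S * A) + S * B
      distrib = solve-∀

      contracted : S * τ (map σ V) (σ r) (rename σ R) ≡ starSum f Φ D (X + x) L
      contracted = trans (cong (S *_) (≋⇒trees (contract-edges f z ℓ x X L D ps ℓ≢rest) (λ w → w) (map σ V) (σ r)))
        (star-trees L D (X + x) (map σ V) (σ r) (z≢rest ∷ u-rest) (trans (weights-contracted X x _ _) ΣS)
          (contract-vertices z ℓ _ ℓ≢rest V≐) (∈-map⁺ σ r∈V))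
        where
          weights-contracted : ∀ X x s t → X + x + (s + t) ≡ X + (x + s + t)
          weights-contracted = solve-∀

      shuffle : (z ∷ ℓ ∷ labels L ++ labels D ++ ps) ↭ (z ∷ labels L ++ ℓ ∷ labels D ++ ps)
      shuffle = ↭.prep z (↭.↭-sym (↭.shift ℓ (labels L) (labels D ++ ps)))

      deleted : S * τ V r R ≡ starSum f Φ ((ℓ , x) ∷ D) X L
      deleted = trans (cong (S *_) (trees-↭ (λ w → w) V r
                  (↭.++⁺ˡ (star f z L) (biclique-↭ (↭.prep (z , X) (↭.↭-sym (↭.shift (ℓ , x) L D))) ps))))
        (star-trees L ((ℓ , x) ∷ D) X V r (Unique-resp-↭ shuffle u) (trans (weights-deleted X x _ _) ΣS)
          (≐-trans V≐ (↭⇒≐ shuffle)) r∈V)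
        where
          weights-deleted : ∀ X x s t → X + (s + (x + t)) ≡ X + (x + s + t)
          weights-deleted = solve-∀

  star-trees₀ : ∀ L V r → Unique (z ∷ labels L ++ ps) → sum (weights L) ≡ S →
    V ≐ (z ∷ labels L ++ ps) → r ∈ V → S * τ V r (star f z L ++ biclique L ps) ≡ starSum f Φ [] 0 L
  star-trees₀ L V r u ΣS V≐ r∈V =
    trans (cong (S *_) (≋⇒trees (≋-++ˡ (star f z L) add-weight-0) (λ w → w) V r))
      (star-trees L [] 0 V r u (trans (+-identityʳ _) ΣS) V≐ r∈V)
    where
      add-weight-0 : biclique L ps ≋ biclique ((z , 0) ∷ L ++ []) ps
      add-weight-0 = ≋-trans (≋-reflexive (cong (λ K → biclique K ps) (sym (List.++-identityʳ L))))
        (≋-concatMap (λ p → ≋-sym (≋-++ʳ (fan p (L ++ [])) (≋-weight-0 p z))) ps)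

-- Spanning trees of weighted complete bipartite graphs

starPoly : (ℕ → ℕ) → ℕ → List WVertex → ℕ → ℕ
starPoly f n []            X = X
starPoly f n ((ℓ , x) ∷ L) X = f x * starPoly f n L (X + x) + n * x * starPoly f n L X

bicliqueCount : ℕ → ℕ → List WVertex → ℕ → ℕ
bicliqueCount S n D X = X * product (weights D) * S ^ n * n ^ length D

starSum-bicliqueCount : ∀ f S n L D X →
  starSum f (bicliqueCount S n) D X L ≡ product (weights D) * n ^ length D * S ^ n * starPoly f n L X
starSum-bicliqueCount f S n [] D X = lemma X (product (weights D)) (S ^ n) (n ^ length D)
  where
    lemma : ∀ X P Sⁿ N → X * P * Sⁿ * N ≡ P * N * Sⁿ * X
    lemma = solve-∀
starSum-bicliqueCount f S n ((ℓ , x) ∷ L) D X =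
  trans (cong₂ (λ a b → f x * a + b)
          (starSum-bicliqueCount f S n L D (X + x)) (starSum-bicliqueCount f S n L ((ℓ , x) ∷ D) X))
    (lemma (f x) x n (product (weights D)) (n ^ length D) (S ^ n) (starPoly f n L (X + x)) (starPoly f n L X))
  where
    lemma : ∀ a x n P N Sⁿ A B → a * (P * N * Sⁿ * A) + x * P * (n * N) * Sⁿ * B ≡ P * N * Sⁿ * (a * A + n * x * B)
    lemma = solve-∀

starPoly-id : ∀ n L X → starPoly (λ y → y) n L X
  ≡ product (weights L) * (X * suc n ^ length L + sum (weights L) * suc n ^ (length L ∸ 1))
starPoly-id n [] X = lemma X
  where
    lemma : ∀ X → X ≡ 1 * (X * 1 + 0 * 1)
    lemma = solve-∀
starPoly-id n ((ℓ , x) ∷ []) X = lemma n x X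
  where
    lemma : ∀ n x X → x * (X + x) + n * x * X ≡ x * 1 * (X * ((1 + n) * 1) + (x + 0) * 1)
    lemma = solve-∀
starPoly-id n ((ℓ , x) ∷ b ∷ L) X =
  trans (cong₂ (λ a c → x * a + n * x * c) (starPoly-id n (b ∷ L) (X + x)) (starPoly-id n (b ∷ L) X))
    (lemma n x X (product (weights (b ∷ L))) (sum (weights (b ∷ L))) (suc n ^ length L))
  where
    lemma : ∀ n x X P s K → x * (P * ((X + x) * ((1 + n) * K) + s * K)) + n * x * (P * (X * ((1 + n) * K) + s * K))
                          ≡ x * P * (X * ((1 + n) * ((1 + n) * K)) + (x + s) * ((1 + n) * K))
    lemma = solve-∀

-- Weighted form of t(K_{a,b}) = a^(b-1) b^(a-1): each vertex of (z , X) ∷ D is joined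
-- to every p ∈ ps by as many edges as its weight, and S is the total weight.  The edges
-- at the first p form a star, so StarContraction reduces ps to its tail.
biclique-trees : ∀ ps z S D X → Unique (z ∷ labels D ++ ps) → X + sum (weights D) ≡ S →
  S * τ (z ∷ labels D ++ ps) z (biclique ((z , X) ∷ D) ps) ≡ bicliqueCount S (length ps) D X
biclique-trees [] z _ [] X u refl rewrite ≡ᵇ-true (refl {x = z}) = lemma X
  where
    lemma : ∀ X → (X + 0) * 1 ≡ X * 1 * 1 * 1
    lemma = solve-∀
biclique-trees [] z _ ((ℓ , x) ∷ D) X ((z≢ℓ ∷ _) ∷ _) refl
  rewrite ≡ᵇ-true (refl {x = z}) | ≡ᵇ-false (z≢ℓ ∘ sym) =
    trans (*-zeroʳ (X + (x + sum (weights D)))) (sym (*-zeroʳ (X * (x * product (weights D)) * 1)))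
biclique-trees (p ∷ ps) z _ D X u refl = begin
  S * τ V z (star (λ y → y) p L ++ biclique L ps)
    ≡⟨ Star.star-trees₀ L V z (Unique-resp-↭ shuffle u) refl (↭⇒≐ shuffle) (here refl) ⟩
  starSum (λ y → y) (bicliqueCount S n) [] 0 L
    ≡⟨ starSum-bicliqueCount (λ y → y) S n L [] 0 ⟩
  1 * 1 * S ^ n * starPoly (λ y → y) n L 0
    ≡⟨ cong (1 * 1 * S ^ n *_) (starPoly-id n L 0) ⟩
  1 * 1 * S ^ n * (X * product (weights D) * (0 * suc n ^ length L + S * suc n ^ length D))
    ≡⟨ lemma X (product (weights D)) S (S ^ n) (suc n ^ length D) (suc n ^ length L) ⟩
  bicliqueCount S (suc n) D X ∎
  where
    open ≡-Reasoning
    S = X + sum (weights D)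
    n = length ps
    L = (z , X) ∷ D
    V = z ∷ labels D ++ p ∷ ps

    module Star = StarContraction (λ y → y) p ps S (bicliqueCount S n) (biclique-trees ps p S)

    shuffle : V ↭ (p ∷ labels L ++ ps)
    shuffle = ↭.shift p (labels L) ps

    lemma : ∀ X P S Sⁿ K K′ → 1 * 1 * Sⁿ * (X * P * (0 * K′ + S * K)) ≡ X * P * (S * Sⁿ) * K
    lemma = solve-∀

-- The half cone

prodShift : ℕ → ℕ → List ℕ → ℕ
prodShift k n []       = 1
prodShift k n (x ∷ xs) = (k + x * n) * prodShift k n xs

cofactorSum : ℕ → ℕ → List ℕ → ℕ
cofactorSum k n []       = 0
cofactorSum k n (x ∷ xs) = k * x * prodShift k n xs + (k + x * n) * cofactorSum k n xs

starPoly-const : ∀ k n L X → starPoly (λ _ → k) n L X ≡ X * prodShift k n (weights L) + cofactorSum k n (weights L)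
starPoly-const k n [] X = lemma X
  where
    lemma : ∀ X → X ≡ X * 1 + 0
    lemma = solve-∀
starPoly-const k n ((ℓ , x) ∷ L) X =
  trans (cong₂ (λ a b → k * a + n * x * b) (starPoly-const k n L (X + x)) (starPoly-const k n L X))
    (lemma k n x X (prodShift k n (weights L)) (cofactorSum k n (weights L)))
  where
    lemma : ∀ k n x X P C → k * ((X + x) * P + C) + n * x * (X * P + C) ≡ X * ((k + x * n) * P) + (k * x * P + (k + x * n) * C)
    lemma = solve-∀

concatMap-transpose : ∀ {A B C : Set} (f : A → B → C) xs ys →
  concatMap (λ x → map (f x) ys) xs ↭ concatMap (λ y → map (λ x → f x y) xs) ys
concatMap-transpose f [] ys = nil ys
  where
    nil : ∀ ys → [] ↭ concatMap (λ _ → []) ys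
    nil []       = ↭.refl
    nil (y ∷ ys) = nil ys
concatMap-transpose f (x ∷ xs) ys =
  ↭.trans (↭.++⁺ˡ (map (f x) ys) (concatMap-transpose f xs ys)) (interleave ys)
  where
    interleave : ∀ ys → map (f x) ys ++ concatMap (λ y → map (λ x → f x y) xs) ys
                      ↭ concatMap (λ y → f x y ∷ map (λ x → f x y) xs) ys
    interleave []       = ↭.refl
    interleave (y ∷ ys) = ↭.prep (f x y)
      (↭.trans (↭.shifts (map (f x) ys) (map (λ x → f x y) xs)) (↭.++⁺ˡ _ (interleave ys)))

applyUpTo-+ : ∀ {A : Set} (f : ℕ → A) m n → applyUpTo f (m + n) ≡ applyUpTo f m ++ applyUpTo (f ∘ (m +_)) n
applyUpTo-+ f zero    n = refl
applyUpTo-+ f (suc m) n = cong (f 0 ∷_) (applyUpTo-+ (f ∘ suc) m n)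

map-allFinL-suc : ∀ {A : Set} m (f : Fin (suc m) → A) →
  map f (allFinL (suc m)) ≡ f Fin.zero ∷ map (f ∘ Fin.suc) (allFinL m)
map-allFinL-suc m f = cong (f Fin.zero ∷_) (sym (List.map-∘ (allFinL m)))

map-toℕ-allFinL : ∀ m → map toℕ (allFinL m) ≡ upTo m
map-toℕ-allFinL zero    = refl
map-toℕ-allFinL (suc m) =
  trans (map-allFinL-suc m toℕ)
    (cong (0 ∷_) (trans (List.map-∘ (allFinL m)) (trans (cong (map suc) (map-toℕ-allFinL m)) (List.map-upTo suc m))))

module HalfCone (k m n : ℕ) (ks : Fin m → ℕ) where

  ps : List ℕ
  ps = upTo n

  apex : ℕ
  apex = n + m

  Q : List WVertex
  Q = map (λ i → (n + toℕ i , ks i)) (allFinL m)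

  S : ℕ
  S = sum (weights Q)

  weights-Q : weights Q ≡ map ks (allFinL m)
  weights-Q = sym (List.map-∘ (allFinL m))

  bipartite-edges : List WEdge
  bipartite-edges = concatMap (λ i → map (λ j → (n + toℕ i , j , ks i)) ps) (allFinL m)

  cone-edges : List WEdge
  cone-edges = map (λ i → (apex , n + toℕ i , k)) (allFinL m)

  edges-halfCone : edges (halfCone k m n ks) ≡ expand (bipartite-edges ++ cone-edges)
  edges-halfCone = sym (trans (List.concatMap-++ _ bipartite-edges cone-edges)
    (cong₂ _++_
      (trans (expand-concatMap _ (allFinL m)) (List.concatMap-cong (λ i → List.concatMap-map _ _ ps) (allFinL m)))
      (List.concatMap-map _ _ (allFinL m))))

  halfCone-≋ : (bipartite-edges ++ cone-edges) ≋ (star (λ _ → k) apex Q ++ biclique Q ps)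
  halfCone-≋ = ≋-trans (↭⇒≋ (↭.++-comm bipartite-edges cone-edges))
    (≋-++ (≋-reflexive (List.map-∘ (allFinL m)))
      (≋-trans (≋-concatMap (λ i → ≋-map (λ j → ≋-flip (n + toℕ i) j (ks i)) ps) (allFinL m))
        (≋-trans (↭⇒≋ (concatMap-transpose (λ i j → (j , n + toℕ i , ks i)) (allFinL m) ps))
          (≋-reflexive (List.concatMap-cong (λ j → List.map-∘ (allFinL m)) ps)))))

  labels-Q : labels Q ≡ applyUpTo (n +_) m
  labels-Q = begin
    map proj₁ (map (λ i → (n + toℕ i , ks i)) (allFinL m)) ≡⟨ List.map-∘ (allFinL m) ⟨
    map ((n +_) ∘ toℕ) (allFinL m)                        ≡⟨ List.map-∘ (allFinL m) ⟩
    map (n +_) (map toℕ (allFinL m))                       ≡⟨ cong (map (n +_)) (map-toℕ-allFinL m) ⟩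
    map (n +_) (upTo m)                                    ≡⟨ List.map-upTo (n +_) m ⟩
    applyUpTo (n +_) m                                     ∎
    where open ≡-Reasoning

  vertices-↭ : upTo (suc (n + m)) ↭ (apex ∷ labels Q ++ ps)
  vertices-↭ = begin
    upTo (suc (n + m))                        ≡⟨ List.upTo-∷ʳ (n + m) ⟨
    upTo (n + m) ++ apex ∷ []                 ≡⟨ cong (_++ apex ∷ []) (applyUpTo-+ (λ i → i) n m) ⟩
    (ps ++ applyUpTo (n +_) m) ++ apex ∷ []   ↭⟨ ↭.++-comm (ps ++ applyUpTo (n +_) m) (apex ∷ []) ⟩
    apex ∷ ps ++ applyUpTo (n +_) m           ↭⟨ ↭.prep apex (↭.++-comm ps (applyUpTo (n +_) m)) ⟩
    apex ∷ applyUpTo (n +_) m ++ ps           ≡⟨ cong (λ K → apex ∷ K ++ ps) labels-Q ⟨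
    apex ∷ labels Q ++ ps                     ∎
    where open ↭.PermutationReasoning

  S*t-halfCone : S * t (halfCone k m n ks) ≡ S ^ n * cofactorSum k n (weights Q)
  S*t-halfCone = begin
    S * t (halfCone k m n ks)
      ≡⟨ cong (S *_) (t≡τ (halfCone k m n ks) (bipartite-edges ++ cone-edges) edges-halfCone) ⟩
    S * τ V 0 (bipartite-edges ++ cone-edges)
      ≡⟨ cong (S *_) (≋⇒trees halfCone-≋ (λ w → w) V 0) ⟩
    S * τ V 0 (star (λ _ → k) apex Q ++ biclique Q ps)
      ≡⟨ Star.star-trees₀ Q V 0 (Unique-resp-↭ vertices-↭ (Unique.upTo⁺ (suc (n + m))))
           refl (↭⇒≐ vertices-↭) (∈-upTo⁺ (s≤s z≤n)) ⟩
    starSum (λ _ → k) (bicliqueCount S (length ps)) [] 0 Q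
      ≡⟨ starSum-bicliqueCount (λ _ → k) S (length ps) Q [] 0 ⟩
    1 * 1 * S ^ length ps * starPoly (λ _ → k) (length ps) Q 0
      ≡⟨ cong (λ l → 1 * 1 * S ^ l * starPoly (λ _ → k) l Q 0) (List.length-upTo n) ⟩
    1 * 1 * S ^ n * starPoly (λ _ → k) n Q 0
      ≡⟨ cong (1 * 1 * S ^ n *_) (starPoly-const k n Q 0) ⟩
    1 * 1 * S ^ n * (0 * prodShift k n (weights Q) + cofactorSum k n (weights Q))
      ≡⟨ lemma (S ^ n) (prodShift k n (weights Q)) (cofactorSum k n (weights Q)) ⟩
    S ^ n * cofactorSum k n (weights Q) ∎
    where
      open ≡-Reasoning
      V = upTo (suc (n + m))
      module Star = StarContraction (λ _ → k) apex ps S (bicliqueCount S (length ps)) (biclique-trees ps apex S)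
      lemma : ∀ Sⁿ P C → 1 * 1 * Sⁿ * (0 * P + C) ≡ Sⁿ * C
      lemma = solve-∀

ιᵘ : ℕ → ℚᵘ
ιᵘ a = mkℚᵘ (ℤ.+ a) 0

-- ι a and x /ₙ suc d are, by definition, fromℚᵘ of the fractions a / 1 and x / suc d.
toℚᵘ-ι : ∀ a → toℚᵘ (ι a) ≃ᵘ ιᵘ a
toℚᵘ-ι a = ℚ.toℚᵘ-fromℚᵘ (ιᵘ a)

ι-+ : ∀ a b → ι (a + b) ≡ ι a ℚ.+ ι b
ι-+ a b = ℚ.toℚᵘ-injective (begin
  toℚᵘ (ι (a + b))             ≈⟨ toℚᵘ-ι (a + b) ⟩
  ιᵘ (a + b)                   ≈⟨ *≡* (trans (ℤ.*-identityʳ (ℤ.+ (a + b))) (trans (ℤ.pos-+ a b)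
                                    (sym (trans (ℤ.*-identityʳ _)
                                      (cong₂ ℤ._+_ (ℤ.*-identityʳ (ℤ.+ a)) (ℤ.*-identityʳ (ℤ.+ b))))))) ⟩
  ιᵘ a ℚᵘ.+ ιᵘ b               ≈⟨ ℚᵘ.+-cong (toℚᵘ-ι a) (toℚᵘ-ι b) ⟨
  toℚᵘ (ι a) ℚᵘ.+ toℚᵘ (ι b)   ≈⟨ ℚ.toℚᵘ-homo-+ (ι a) (ι b) ⟨
  toℚᵘ (ι a ℚ.+ ι b)           ∎)
  where open ℚᵘ.≃-Reasoning

ι-* : ∀ a b → ι (a * b) ≡ ι a ℚ.* ι b
ι-* a b = ℚ.toℚᵘ-injective (begin
  toℚᵘ (ι (a * b))             ≈⟨ toℚᵘ-ι (a * b) ⟩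
  ιᵘ (a * b)                   ≈⟨ *≡* (trans (ℤ.*-identityʳ (ℤ.+ (a * b))) (trans (ℤ.pos-* a b) (sym (ℤ.*-identityʳ _)))) ⟩
  ιᵘ a ℚᵘ.* ιᵘ b               ≈⟨ ℚᵘ.*-cong (toℚᵘ-ι a) (toℚᵘ-ι b) ⟨
  toℚᵘ (ι a) ℚᵘ.* toℚᵘ (ι b)   ≈⟨ ℚ.toℚᵘ-homo-* (ι a) (ι b) ⟨
  toℚᵘ (ι a ℚ.* ι b)           ∎)
  where open ℚᵘ.≃-Reasoning

ι-^ : ∀ a e → ι (a ^ e) ≡ powQ (ι a) e
ι-^ a zero    = refl
ι-^ a (suc e) = trans (ι-* a (a ^ e)) (cong (ι a ℚ.*_) (ι-^ a e))

ι-*-/ₙ : ∀ x d → ι (suc d) ℚ.* (x /ₙ suc d) ≡ ι x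
ι-*-/ₙ x d = ℚ.toℚᵘ-injective (begin
  toℚᵘ (ι (suc d) ℚ.* (x /ₙ suc d))              ≈⟨ ℚ.toℚᵘ-homo-* (ι (suc d)) (x /ₙ suc d) ⟩
  toℚᵘ (ι (suc d)) ℚᵘ.* toℚᵘ (x /ₙ suc d)        ≈⟨ ℚᵘ.*-cong (toℚᵘ-ι (suc d)) (ℚ.toℚᵘ-fromℚᵘ (mkℚᵘ (ℤ.+ x) d)) ⟩
  ιᵘ (suc d) ℚᵘ.* mkℚᵘ (ℤ.+ x) d                 ≈⟨ *≡* cross-multiplied ⟩
  ιᵘ x                                            ≈⟨ toℚᵘ-ι x ⟨
  toℚᵘ (ι x)                                      ∎)
  where
    open ℚᵘ.≃-Reasoning
    cross-multiplied : ℤ.+ (suc d) ℤ.* ℤ.+ x ℤ.* ℤ.+ 1 ≡ ℤ.+ x ℤ.* ℤ.+ (suc (d + 0))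
    cross-multiplied = trans (ℤ.*-identityʳ _) (trans (sym (ℤ.pos-* (suc d) x))
      (trans (cong ℤ.+_ (trans (*-comm (suc d) x) (cong (x *_) (sym (+-identityʳ (suc d))))))
        (ℤ.pos-* x (suc (d + 0)))))

sum-allFinL : ∀ m (ks : Fin m → ℕ) → sum (map ks (allFinL m)) ≡ sumF m ks
sum-allFinL zero    ks = refl
sum-allFinL (suc m) ks = trans (cong sum (map-allFinL-suc m ks)) (cong (ks Fin.zero +_) (sum-allFinL m (ks ∘ Fin.suc)))

ι-prodShift : ∀ k n m (ks : Fin m → ℕ) →
  ι (prodShift k n (map ks (allFinL m))) ≡ prodQ m (λ i → ι (k + ks i * n))
ι-prodShift k n zero    ks = refl
ι-prodShift k n (suc m) ks = begin
  ι (prodShift k n (map ks (allFinL (suc m))))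
    ≡⟨ cong (ι ∘ prodShift k n) (map-allFinL-suc m ks) ⟩
  ι ((k + ks Fin.zero * n) * prodShift k n (map (ks ∘ Fin.suc) (allFinL m)))
    ≡⟨ ι-* (k + ks Fin.zero * n) (prodShift k n (map (ks ∘ Fin.suc) (allFinL m))) ⟩
  ι (k + ks Fin.zero * n) ℚ.* ι (prodShift k n (map (ks ∘ Fin.suc) (allFinL m)))
    ≡⟨ cong (ι (k + ks Fin.zero * n) ℚ.*_) (ι-prodShift k n m (ks ∘ Fin.suc)) ⟩
  prodQ (suc m) (λ i → ι (k + ks i * n)) ∎
  where open ≡-Reasoning

ι-cofactorSum : ∀ k n m (ks : Fin m → ℕ) → let K = suc k in
  ι (cofactorSum K n (map ks (allFinL m)))
    ≡ ι K ℚ.* prodQ m (λ i → ι (K + ks i * n)) ℚ.* sumQ m (λ i → ks i /ₙ (K + ks i * n))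
ι-cofactorSum k n zero    ks = sym (ℚ.*-zeroʳ (ι (suc k) ℚ.* ℚ.1ℚ))
ι-cofactorSum k n (suc m) ks = begin
  ι (cofactorSum K n (map ks (allFinL (suc m))))
    ≡⟨ cong (ι ∘ cofactorSum K n) (map-allFinL-suc m ks) ⟩
  ι (K * x * P + (K + x * n) * C)
    ≡⟨ trans (ι-+ (K * x * P) ((K + x * n) * C))
         (cong₂ ℚ._+_ (trans (ι-* (K * x) P) (cong (ℚ._* ι P) (ι-* K x))) (ι-* (K + x * n) C)) ⟩
  ι K ℚ.* ι x ℚ.* ι P ℚ.+ ι (K + x * n) ℚ.* ι C
    ≡⟨ cong₂ (λ a b → ι K ℚ.* a ℚ.* ι P ℚ.+ ι (K + x * n) ℚ.* b)
         (sym (ι-*-/ₙ x (k + x * n))) (ι-cofactorSum k n m (ks ∘ Fin.suc)) ⟩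
  ι K ℚ.* (ι (K + x * n) ℚ.* (x /ₙ (K + x * n))) ℚ.* ι P ℚ.+ ι (K + x * n) ℚ.* (ι K ℚ.* ΠQ ℚ.* ΣQ)
    ≡⟨ cong (λ a → ι K ℚ.* (ι (K + x * n) ℚ.* (x /ₙ (K + x * n))) ℚ.* a ℚ.+ ι (K + x * n) ℚ.* (ι K ℚ.* ΠQ ℚ.* ΣQ))
         (ι-prodShift K n m (ks ∘ Fin.suc)) ⟩
  ι K ℚ.* (ι (K + x * n) ℚ.* (x /ₙ (K + x * n))) ℚ.* ΠQ ℚ.+ ι (K + x * n) ℚ.* (ι K ℚ.* ΠQ ℚ.* ΣQ)
    ≡⟨ factor (ι K) (ι (K + x * n)) (x /ₙ (K + x * n)) ΠQ ΣQ ⟩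
  ι K ℚ.* (ι (K + x * n) ℚ.* ΠQ) ℚ.* ((x /ₙ (K + x * n)) ℚ.+ ΣQ) ∎
  where
    open ≡-Reasoning
    K = suc k
    x = ks Fin.zero
    P = prodShift K n (map (ks ∘ Fin.suc) (allFinL m))
    C = cofactorSum K n (map (ks ∘ Fin.suc) (allFinL m))
    ΠQ = prodQ m (λ i → ι (K + ks (Fin.suc i) * n))
    ΣQ = sumQ m (λ i → ks (Fin.suc i) /ₙ (K + ks (Fin.suc i) * n))
    open ℚ-Solver using (solve; _:*_; _:+_; _:=_)
    factor : ∀ a b q Π Σ → a ℚ.* (b ℚ.* q) ℚ.* Π ℚ.+ b ℚ.* (a ℚ.* Π ℚ.* Σ) ≡ a ℚ.* (b ℚ.* Π) ℚ.* (q ℚ.+ Σ)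
    factor = solve 5 (λ a b q Π Σ → a :* (b :* q) :* Π :+ b :* (a :* Π :* Σ) := a :* (b :* Π) :* (q :+ Σ)) refl

t-halfCone : ∀ k m n (ks : Fin m → ℕ) → 1 ≤ sum (map ks (allFinL m)) →
  t (halfCone k m (suc n) ks) ≡ sum (map ks (allFinL m)) ^ n * cofactorSum k (suc n) (map ks (allFinL m))
t-halfCone k m n ks S≥1 = *-cancelˡ-≡ _ _ S {{>-nonZero S≥1}} (begin
  S * t (halfCone k m (suc n) ks)
    ≡⟨ subst (λ ws → sum ws * t (halfCone k m (suc n) ks) ≡ sum ws ^ suc n * cofactorSum k (suc n) ws)
         (HalfCone.weights-Q k m (suc n) ks) (HalfCone.S*t-halfCone k m (suc n) ks) ⟩
  S ^ suc n * C    ≡⟨ *-assoc S (S ^ n) C ⟩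
  S * (S ^ n * C)  ∎)
  where
    open ≡-Reasoning
    S = sum (map ks (allFinL m))
    C = cofactorSum k (suc n) (map ks (allFinL m))

t-halfCone-ℚ : ∀ k m n (ks : Fin (suc m) → ℕ) → 1 ≤ ks Fin.zero → let K = suc k ; M = suc m ; N = suc n in
  ι (t (halfCone K M N ks))
    ≡ powQ (ι (sumF M ks)) n ℚ.* ι K ℚ.* prodQ M (λ i → ι (K + ks i * N)) ℚ.* sumQ M (λ i → ks i /ₙ (K + ks i * N))
t-halfCone-ℚ k m n ks ks₀≥1 = begin
  ι (t (halfCone K M N ks))
    ≡⟨ cong ι (t-halfCone K M n ks (≤-trans ks₀≥1 (m≤m+n (ks Fin.zero) _))) ⟩
  ι (S ^ n * cofactorSum K N (map ks (allFinL M)))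
    ≡⟨ ι-* (S ^ n) _ ⟩
  ι (S ^ n) ℚ.* ι (cofactorSum K N (map ks (allFinL M)))
    ≡⟨ cong₂ ℚ._*_ (trans (ι-^ S n) (cong (λ a → powQ (ι a) n) (sum-allFinL M ks))) (ι-cofactorSum k N M ks) ⟩
  powQ (ι (sumF M ks)) n ℚ.* (ι K ℚ.* Π ℚ.* Σ)
    ≡⟨ assoc (powQ (ι (sumF M ks)) n) (ι K) Π Σ ⟩
  powQ (ι (sumF M ks)) n ℚ.* ι K ℚ.* Π ℚ.* Σ ∎
  where
    open ≡-Reasoning
    K = suc k
    M = suc m
    N = suc n
    S = sum (map ks (allFinL M))
    Π = prodQ M (λ i → ι (K + ks i * N))
    Σ = sumQ M (λ i → ks i /ₙ (K + ks i * N))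
    open ℚ-Solver using (solve; _:*_; _:=_)
    assoc : ∀ a b c d → a ℚ.* (b ℚ.* c ℚ.* d) ≡ a ℚ.* b ℚ.* c ℚ.* d
    assoc = solve 4 (λ a b c d → a :* (b :* c :* d) := a :* b :* c :* d) refl

map-const-allFinL : ∀ m (s : ℕ) → map (λ _ → s) (allFinL m) ≡ replicate m s
map-const-allFinL zero    s = refl
map-const-allFinL (suc m) s = trans (map-allFinL-suc m (λ _ → s)) (cong (s ∷_) (map-const-allFinL m s))

sum-replicate : ∀ m s → sum (replicate m s) ≡ m * s
sum-replicate zero    s = refl
sum-replicate (suc m) s = cong (s +_) (sum-replicate m s)

prodShift-replicate : ∀ k n m s → prodShift k n (replicate m s) ≡ (k + s * n) ^ m
prodShift-replicate k n zero    s = refl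
prodShift-replicate k n (suc m) s = cong ((k + s * n) *_) (prodShift-replicate k n m s)

cofactorSum-replicate : ∀ k n m s → cofactorSum k n (replicate m s) ≡ m * (k * s * (k + s * n) ^ (m ∸ 1))
cofactorSum-replicate k n zero          s = refl
cofactorSum-replicate k n (suc zero)    s = lemma k n s
  where
    lemma : ∀ k n s → k * s * 1 + (k + s * n) * 0 ≡ 1 * (k * s * 1)
    lemma = solve-∀
cofactorSum-replicate k n (suc (suc m)) s =
  trans (cong₂ (λ P C → k * s * P + (k + s * n) * C)
          (prodShift-replicate k n (suc m) s) (cofactorSum-replicate k n (suc m) s))
    (lemma k n s m ((k + s * n) ^ m))
  where
    lemma : ∀ k n s m X → k * s * ((k + s * n) * X) + (k + s * n) * ((1 + m) * (k * s * X))
                        ≡ (2 + m) * (k * s * ((k + s * n) * X))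
    lemma = solve-∀

^-distribʳ-* : ∀ a b e → (a * b) ^ e ≡ a ^ e * b ^ e
^-distribʳ-* a b zero    = refl
^-distribʳ-* a b (suc e) = trans (cong (a * b *_) (^-distribʳ-* a b e)) (lemma a b (a ^ e) (b ^ e))
  where
    lemma : ∀ a b A B → a * b * (A * B) ≡ a * A * (b * B)
    lemma = solve-∀

t-halfCone-uniform : ∀ k m n s → 1 ≤ s → let K = suc k ; M = suc m ; N = suc n in
  t (halfCone K M N (λ _ → s)) ≡ s ^ N * M ^ N * K * (K + s * N) ^ m
t-halfCone-uniform k m n s s≥1 = begin
  t (halfCone K M N (λ _ → s))
    ≡⟨ t-halfCone K M n (λ _ → s) (≤-trans s≥1 (m≤m+n s _)) ⟩
  sum ws ^ n * cofactorSum K N ws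
    ≡⟨ cong (λ ws → sum ws ^ n * cofactorSum K N ws) (map-const-allFinL M s) ⟩
  sum (replicate M s) ^ n * cofactorSum K N (replicate M s)
    ≡⟨ cong₂ (λ a b → a ^ n * b) (sum-replicate M s) (cofactorSum-replicate K N M s) ⟩
  (M * s) ^ n * (M * (K * s * (K + s * N) ^ m))
    ≡⟨ cong (_* (M * (K * s * (K + s * N) ^ m))) (^-distribʳ-* M s n) ⟩
  M ^ n * s ^ n * (M * (K * s * (K + s * N) ^ m))
    ≡⟨ lemma M s K (M ^ n) (s ^ n) ((K + s * N) ^ m) ⟩
  s ^ N * M ^ N * K * (K + s * N) ^ m ∎
  where
    open ≡-Reasoning
    K = suc k
    M = suc m
    N = suc n
    ws = map (λ _ → s) (allFinL M)
    lemma : ∀ M s K Mⁿ sⁿ X → Mⁿ * sⁿ * (M * (K * s * X)) ≡ s * sⁿ * (M * Mⁿ) * K * X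
    lemma = solve-∀

theorem5p2 : (k m n : ℕ) → 1 ≤ k → 1 ≤ m → 1 ≤ n →
    ((ks : Fin m → ℕ) → (∀ i → 1 ≤ ks i) →
      ι (t (halfCone k m n ks))
        ≡ powQ (ι (sumF m ks)) (n ∸ 1) *ℚ ι k
          *ℚ prodQ m (λ i → ι (k + ks i * n))
          *ℚ sumQ m (λ i → ks i /ₙ (k + ks i * n)))
    × ((s : ℕ) → 1 ≤ s →
      t (halfCone k m n (λ _ → s)) ≡ s ^ n * m ^ n * k * (k + s * n) ^ (m ∸ 1))
theorem5p2 (suc k) (suc m) (suc n) _ _ _ =
  (λ ks ks≥1 → t-halfCone-ℚ k m n ks (ks≥1 Fin.zero)) , t-halfCone-uniform k m n
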